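{- Let $g(x)$ be an integer-valued polynomial of degree $d\ge1$ with positive leading coefficient, and let $\ell_1,\ell_2$ be positive integers. Let $I=\{(i,j): i=1,\dots,\ell_1,\ j=1,\dots,\ell_2,\ j\ge 2/d\}$ and for $(i,j)\in I$ let $$f_{i,j}(x)=i\,g(x)^j+h_{i,j}(x),$$ where $h_{i,j}(x)$ are arbitrary integer-valued polynomials of degree $\le dj-2$. Then for every non-empty subset $\mathcal{S}\subseteq I$ there exist $(i_1,j_1)\in\mathcal{S}$ and an integer $A$ such that $f_{i_1,j_1}(x+A)\not\equiv f_{i_2,j_2}(Bx+C)+D$ for all $(i_2,j_2)\in\mathcal{S}\setminus\{(i_1,j_1)\}$, all integers $C$, $D$ and all positive rational numbers $B$.
   Context: A polynomial $f(x)$ is integer-valued if $f(n)\in\mathbb{Z}$ for every positive integer $n$. $F(x)\not\equiv G(x)$ means the polynomials are not identically equal. -}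

module Defs where

open import Data.Nat as ℕ using (ℕ; zero; suc)
open import Data.Integer as ℤ using (ℤ; +_)
open import Data.Rational using (ℚ; 0ℚ; 1ℚ; _/_; _+_; _*_; _<_)
open import Data.List using (List; []; _∷_)
open import Data.Product using (_×_; Σ; ∃; _,_)
open import Relation.Binary.PropositionalEquality using (_≡_)

-- A polynomial with rational coefficients, as the list of its
-- coefficients from the constant term upwards: a₀ ∷ a₁ ∷ … represents a₀ + a₁x + ….
Poly : Set
Poly = List ℚ

ℤ→ℚ : ℤ → ℚ
ℤ→ℚ z = z / 1

ℕ→ℚ : ℕ → ℚ
ℕ→ℚ n = ℤ→ℚ (+ n)

eval : Poly → ℚ → ℚ
eval []       x = 0ℚ
eval (a ∷ as) x = a + x * eval as x

coeff : Poly → ℕ → ℚ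
coeff []       k       = 0ℚ
coeff (a ∷ as) zero    = a
coeff (a ∷ as) (suc k) = coeff as k

_^_ : ℚ → ℕ → ℚ
x ^ zero  = 1ℚ
x ^ suc n = x * (x ^ n)

DegLe : Poly → ℕ → Set
DegLe p n = ∀ k → n ℕ.< k → coeff p k ≡ 0ℚ

DegPosLead : Poly → ℕ → Set
DegPosLead p d = DegLe p d × (0ℚ < coeff p d)

IntegerValued : Poly → Set
IntegerValued p = ∀ (n : ℕ) → 1 ℕ.≤ n → ∃ λ (z : ℤ) → eval p (ℕ→ℚ n) ≡ ℤ→ℚ z

-- Membership of (i , j) in I = {(i,j) : 1 ≤ i ≤ ℓ₁, 1 ≤ j ≤ ℓ₂, j ≥ 2/d},
-- the last condition written as 2 ≤ d·j.
InI : ℕ → ℕ → ℕ → ℕ × ℕ → Set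
InI d ℓ₁ ℓ₂ (i , j) = (1 ℕ.≤ i × i ℕ.≤ ℓ₁) × (1 ℕ.≤ j × j ℕ.≤ ℓ₂) × 2 ℕ.≤ d ℕ.* j

fij : Poly → (ℕ → ℕ → Poly) → ℕ × ℕ → ℚ → ℚ
fij g h (i , j) x = ℕ→ℚ i * (eval g x ^ j) + eval (h i j) x

{-# OPTIONS --safe #-}
-- Let d = deg g, let a, b be the coefficients of x^d and x^(d−1) in g, and write
-- t = b / (d a) = p / q in lowest terms. Take (i₁, j₁) ∈ S with j₁ maximal and, among
-- those, i₁ minimal, and A with no divisor of X = A q + p in 2, …, ℓ₁. Suppose
-- f_{i₁,j₁}(x + A) = f_{i₂,j₂}(Bx + C) + D and compare the coefficients of x^(dj) and
-- x^(dj−1), which neither h nor D reaches because dj ≥ 2. If j₂ < j₁ the degrees differ.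
-- If j₂ = j₁ = j then i₁ < i₂, i₁ = i₂ B^(dj) and B (t + A) = t + C, so Y = C q + p = B X
-- and i₂ Y^(dj) = i₁ X^(dj); as i₂ ≤ ℓ₁ is coprime to X, i₂ divides i₁ < i₂.
module Submission where

open import Defs
open import Data.Empty using (⊥-elim)
open import Data.Integer as ℤ using (ℤ; +_)
import Data.Integer.Divisibility.Signed as ℤD
import Data.Integer.Properties as ℤP
open import Data.Integer.Tactic.RingSolver using () renaming (solve-∀ to ℤ-solve-∀)
open import Data.List using (List; []; _∷_; length)
open import Data.List.Membership.Propositional using (_∈_)
open import Data.List.Relation.Unary.All as All using (All; []; _∷_; lookup)
open import Data.List.Relation.Unary.Any using (here; there)
open import Data.Nat as ℕ using (ℕ; zero; suc; z≤n; s≤s; _!)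
open import Data.Nat.Coprimality as Coprimality using (Coprime)
open import Data.Nat.Divisibility as ℕD using (_∣_; _∤_; divides)
open import Data.Nat.Divisibility.Core using (hasNonTrivialDivisor)
open import Data.Nat.Primality
  using (Prime; _Rough_; euclidsLemma; ¬prime[1]; 0-rough; 1-rough; 2-rough; ∤⇒rough-suc; rough∧∣⇒prime)
import Data.Nat.Properties as ℕP
open import Data.Nat.Tactic.RingSolver using () renaming (solve-∀ to ℕ-solve-∀)
open import Data.Product using (_×_; _,_; proj₁; proj₂; ∃-syntax)
open import Data.Rational as ℚ using (ℚ; mkℚ; 0ℚ; 1ℚ; _+_; _*_; -_; _<_)
import Data.Rational.Properties as ℚP
import Data.Rational.Unnormalised as ℚᵘ
import Data.Rational.Unnormalised.Properties as ℚᵘP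
open import Data.Sum using (_⊎_; inj₁; inj₂)
open import Level using (0ℓ)
open import Relation.Binary.Definitions using (Transitive; Total; tri<; tri≈; tri>)
open import Relation.Binary.PropositionalEquality
open import Relation.Nullary using (¬_; yes; no; contradiction)
open import Relation.Nullary.Decidable using (dec⇒maybe)
open import Tactic.RingSolver using (solve-∀)
open import Tactic.RingSolver.Core.AlmostCommutativeRing using (AlmostCommutativeRing; fromCommutativeRing)

ℚ-ring : AlmostCommutativeRing 0ℓ 0ℓ
ℚ-ring = fromCommutativeRing ℚP.+-*-commutativeRing (λ x → dec⇒maybe (0ℚ ℚP.≟ x))

*-cancelˡ-≡ : ∀ x y z .{{_ : ℚ.NonZero x}} → x * y ≡ x * z → y ≡ z
*-cancelˡ-≡ x y z eq = trans (sym (1/x*[x*w]≡w y)) (trans (cong (ℚ.1/ x *_) eq) (1/x*[x*w]≡w z))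
  where
  1/x*[x*w]≡w : ∀ w → ℚ.1/ x * (x * w) ≡ w
  1/x*[x*w]≡w w = begin
    ℚ.1/ x * (x * w)  ≡⟨ ℚP.*-assoc (ℚ.1/ x) x w ⟨
    ℚ.1/ x * x * w    ≡⟨ cong (_* w) (ℚP.*-inverseˡ x) ⟩
    1ℚ * w            ≡⟨ ℚP.*-identityˡ w ⟩
    w                 ∎
    where open ≡-Reasoning

*-pos : ∀ {x y} → 0ℚ < x → 0ℚ < y → 0ℚ < x * y
*-pos {x} {y} x>0 y>0 =
  ℚP.positive⁻¹ (x * y) {{ℚP.pos*pos⇒pos x {{ℚ.positive x>0}} y {{ℚ.positive y>0}}}}

^-pos : ∀ {x} n → 0ℚ < x → 0ℚ < x ^ n
^-pos zero    x>0 = ℚP.positive⁻¹ 1ℚ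
^-pos (suc n) x>0 = *-pos x>0 (^-pos n x>0)

1^n≡1 : ∀ n → 1ℚ ^ n ≡ 1ℚ
1^n≡1 zero    = refl
1^n≡1 (suc n) = trans (ℚP.*-identityˡ (1ℚ ^ n)) (1^n≡1 n)

^-distribʳ-* : ∀ x y n → (x * y) ^ n ≡ x ^ n * y ^ n
^-distribʳ-* x y zero    = refl
^-distribʳ-* x y (suc n) = trans (cong (x * y *_) (^-distribʳ-* x y n)) (lemma x y (x ^ n) (y ^ n))
  where
  lemma : ∀ x y u v → x * y * (u * v) ≡ x * u * (y * v)
  lemma = solve-∀ ℚ-ring

-- Integers inside ℚ

toℚᵘ-ℤ→ℚ : ∀ z → ℚ.toℚᵘ (ℤ→ℚ z) ≡ ℚᵘ.mkℚᵘ z 0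
toℚᵘ-ℤ→ℚ z = cong ℚ.toℚᵘ (ℚP.↥p/↧p≡p (mkℚ z 0 (Coprimality.sym (Coprimality.1-coprimeTo ℤ.∣ z ∣))))

-- The normalising fraction z / 1 does not compute for a variable z, so identities
-- for ℤ→ℚ are checked in ℚᵘ, where it is just mkℚᵘ z 0.
ℤ→ℚ-≃ : ∀ z r → ℚᵘ.mkℚᵘ z 0 ℚᵘ.≃ ℚ.toℚᵘ r → ℤ→ℚ z ≡ r
ℤ→ℚ-≃ z r eq = ℚP.toℚᵘ-injective (ℚᵘP.≃-trans (ℚᵘP.≃-reflexive (toℚᵘ-ℤ→ℚ z)) eq)

ℤ→ℚ-+ : ∀ z w → ℤ→ℚ (z ℤ.+ w) ≡ ℤ→ℚ z + ℤ→ℚ w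
ℤ→ℚ-+ z w = ℤ→ℚ-≃ (z ℤ.+ w) (ℤ→ℚ z + ℤ→ℚ w)
  (ℚᵘP.≃-sym (ℚᵘP.≃-trans (ℚP.toℚᵘ-homo-+ (ℤ→ℚ z) (ℤ→ℚ w))
  (ℚᵘP.≃-trans (ℚᵘP.≃-reflexive (cong₂ ℚᵘ._+_ (toℚᵘ-ℤ→ℚ z) (toℚᵘ-ℤ→ℚ w))) (ℚᵘ.*≡* (lemma z w)))))
  where
  lemma : ∀ z w → (z ℤ.* + 1 ℤ.+ w ℤ.* + 1) ℤ.* + 1 ≡ (z ℤ.+ w) ℤ.* (+ 1 ℤ.* + 1)
  lemma = ℤ-solve-∀

ℤ→ℚ-* : ∀ z w → ℤ→ℚ (z ℤ.* w) ≡ ℤ→ℚ z * ℤ→ℚ w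
ℤ→ℚ-* z w = ℤ→ℚ-≃ (z ℤ.* w) (ℤ→ℚ z * ℤ→ℚ w)
  (ℚᵘP.≃-sym (ℚᵘP.≃-trans (ℚP.toℚᵘ-homo-* (ℤ→ℚ z) (ℤ→ℚ w))
  (ℚᵘP.≃-trans (ℚᵘP.≃-reflexive (cong₂ ℚᵘ._*_ (toℚᵘ-ℤ→ℚ z) (toℚᵘ-ℤ→ℚ w))) (ℚᵘ.*≡* refl))))

ℤ→ℚ-injective : ∀ {z w} → ℤ→ℚ z ≡ ℤ→ℚ w → z ≡ w
ℤ→ℚ-injective {z} {w} eq with ℚP.toℚᵘ-cong eq
... | ≃-eq rewrite toℚᵘ-ℤ→ℚ z | toℚᵘ-ℤ→ℚ w with ≃-eq
...   | ℚᵘ.*≡* z*1≡w*1 = trans (sym (ℤP.*-identityʳ z)) (trans z*1≡w*1 (ℤP.*-identityʳ w))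

ℤ→ℚ-^ : ∀ z n → ℤ→ℚ (z ℤ.^ n) ≡ ℤ→ℚ z ^ n
ℤ→ℚ-^ z zero    = refl
ℤ→ℚ-^ z (suc n) = trans (ℤ→ℚ-* z (z ℤ.^ n)) (cong (ℤ→ℚ z *_) (ℤ→ℚ-^ z n))

ℕ→ℚ-suc : ∀ n → ℕ→ℚ (suc n) ≡ 1ℚ + ℕ→ℚ n
ℕ→ℚ-suc n = ℤ→ℚ-+ (+ 1) (+ n)

ℕ→ℚ-* : ∀ m n → ℕ→ℚ (m ℕ.* n) ≡ ℕ→ℚ m * ℕ→ℚ n
ℕ→ℚ-* m n = trans (cong ℤ→ℚ (ℤP.pos-* m n)) (ℤ→ℚ-* (+ m) (+ n))

ℕ→ℚ-pos : ∀ n → 0ℚ < ℕ→ℚ (suc n)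
ℕ→ℚ-pos n = ℚP.toℚᵘ-cancel-<
  (subst (ℚᵘ._<_ (ℚ.toℚᵘ 0ℚ)) (sym (toℚᵘ-ℤ→ℚ (+ suc n))) (ℚᵘ.*<* (ℤ.+<+ (s≤s z≤n))))

ℤ→ℚ-↥ : ∀ r → ℤ→ℚ (ℚ.↥ r) ≡ r * ℕ→ℚ (ℚ.↧ₙ r)
ℤ→ℚ-↥ r@(mkℚ n d _) = ℤ→ℚ-≃ n (r * ℕ→ℚ (suc d))
  (ℚᵘP.≃-sym (ℚᵘP.≃-trans (ℚP.toℚᵘ-homo-* r (ℕ→ℚ (suc d)))
  (ℚᵘP.≃-trans (ℚᵘP.≃-reflexive (cong (ℚᵘ._*_ (ℚ.toℚᵘ r)) (toℚᵘ-ℤ→ℚ (+ suc d)))) (ℚᵘ.*≡* (lemma n d)))))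
  where
  lemma : ∀ n d → n ℤ.* + suc d ℤ.* + 1 ≡ n ℤ.* + (suc d ℕ.* 1)
  lemma n d rewrite ℕP.*-identityʳ d = ℤP.*-identityʳ (n ℤ.* + suc d)

∣^∣ : ∀ z n → ℤ.∣ z ℤ.^ n ∣ ≡ ℤ.∣ z ∣ ℕ.^ n
∣^∣ z zero    = refl
∣^∣ z (suc n) = trans (ℤP.abs-* z (z ℤ.^ n)) (cong (ℤ.∣ z ∣ ℕ.*_) (∣^∣ z n))

ℤ→ℚ-monomial : ∀ i z n → ℤ→ℚ (+ i ℤ.* z ℤ.^ n) ≡ ℕ→ℚ i * ℤ→ℚ z ^ n
ℤ→ℚ-monomial i z n = trans (ℤ→ℚ-* (+ i) (z ℤ.^ n)) (cong (ℕ→ℚ i *_) (ℤ→ℚ-^ z n))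

∣monomial∣ : ∀ i z n → ℤ.∣ + i ℤ.* z ℤ.^ n ∣ ≡ i ℕ.* ℤ.∣ z ∣ ℕ.^ n
∣monomial∣ i z n = trans (ℤP.abs-* (+ i) (z ℤ.^ n)) (cong (i ℕ.*_) (∣^∣ z n))

monomial-cast : ∀ i₁ i₂ X Y N → ℕ→ℚ i₂ * ℤ→ℚ Y ^ N ≡ ℕ→ℚ i₁ * ℤ→ℚ X ^ N →
                i₂ ℕ.* ℤ.∣ Y ∣ ℕ.^ N ≡ i₁ ℕ.* ℤ.∣ X ∣ ℕ.^ N
monomial-cast i₁ i₂ X Y N eq = begin
  i₂ ℕ.* ℤ.∣ Y ∣ ℕ.^ N      ≡⟨ ∣monomial∣ i₂ Y N ⟨
  ℤ.∣ + i₂ ℤ.* Y ℤ.^ N ∣    ≡⟨ cong ℤ.∣_∣ (ℤ→ℚ-injective {+ i₂ ℤ.* Y ℤ.^ N} {+ i₁ ℤ.* X ℤ.^ N} eq′) ⟩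
  ℤ.∣ + i₁ ℤ.* X ℤ.^ N ∣    ≡⟨ ∣monomial∣ i₁ X N ⟩
  i₁ ℕ.* ℤ.∣ X ∣ ℕ.^ N      ∎
  where
  open ≡-Reasoning
  eq′ : ℤ→ℚ (+ i₂ ℤ.* Y ℤ.^ N) ≡ ℤ→ℚ (+ i₁ ℤ.* X ℤ.^ N)
  eq′ = trans (ℤ→ℚ-monomial i₂ Y N) (trans eq (sym (ℤ→ℚ-monomial i₁ X N)))

-- Polynomial arithmetic

infixl 6 _⊕_
infixl 7 _⊗_ _·ₚ_
infixr 8 _^ₚ_
infix 4 _≈ₚ_

_⊕_ : Poly → Poly → Poly
[]      ⊕ q       = q
(a ∷ p) ⊕ []      = a ∷ p
(a ∷ p) ⊕ (b ∷ q) = a + b ∷ p ⊕ q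

_·ₚ_ : ℚ → Poly → Poly
c ·ₚ []      = []
c ·ₚ (a ∷ p) = c * a ∷ c ·ₚ p

_⊗_ : Poly → Poly → Poly
[]      ⊗ q = []
(a ∷ p) ⊗ q = a ·ₚ q ⊕ (0ℚ ∷ p ⊗ q)

const : ℚ → Poly
const c = c ∷ []

linear : ℚ → ℚ → Poly
linear B C = C ∷ B ∷ []

_∘ₚ_ : Poly → Poly → Poly
[]      ∘ₚ L = []
(a ∷ p) ∘ₚ L = L ⊗ (p ∘ₚ L) ⊕ const a

_^ₚ_ : Poly → ℕ → Poly
p ^ₚ zero  = const 1ℚ
p ^ₚ suc n = p ⊗ p ^ₚ n

_≈ₚ_ : Poly → Poly → Set
p ≈ₚ q = ∀ k → coeff p k ≡ coeff q k

eval-⊕ : ∀ p q x → eval (p ⊕ q) x ≡ eval p x + eval q x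
eval-⊕ []      q       x = sym (ℚP.+-identityˡ (eval q x))
eval-⊕ (a ∷ p) []      x = sym (ℚP.+-identityʳ (eval (a ∷ p) x))
eval-⊕ (a ∷ p) (b ∷ q) x rewrite eval-⊕ p q x = lemma a b x (eval p x) (eval q x)
  where
  lemma : ∀ a b x u v → a + b + x * (u + v) ≡ a + x * u + (b + x * v)
  lemma = solve-∀ ℚ-ring

eval-·ₚ : ∀ c p x → eval (c ·ₚ p) x ≡ c * eval p x
eval-·ₚ c []      x = sym (ℚP.*-zeroʳ c)
eval-·ₚ c (a ∷ p) x rewrite eval-·ₚ c p x = lemma c a x (eval p x)
  where
  lemma : ∀ c a x u → c * a + x * (c * u) ≡ c * (a + x * u)
  lemma = solve-∀ ℚ-ring

eval-⊗ : ∀ p q x → eval (p ⊗ q) x ≡ eval p x * eval q x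
eval-⊗ []      q x = sym (ℚP.*-zeroˡ (eval q x))
eval-⊗ (a ∷ p) q x
  rewrite eval-⊕ (a ·ₚ q) (0ℚ ∷ p ⊗ q) x | eval-·ₚ a q x | eval-⊗ p q x = lemma a x (eval p x) (eval q x)
  where
  lemma : ∀ a x u v → a * v + (0ℚ + x * (u * v)) ≡ (a + x * u) * v
  lemma = solve-∀ ℚ-ring

eval-const : ∀ c x → eval (const c) x ≡ c
eval-const c x = lemma c x
  where
  lemma : ∀ c x → c + x * 0ℚ ≡ c
  lemma = solve-∀ ℚ-ring

eval-linear : ∀ B C x → eval (linear B C) x ≡ B * x + C
eval-linear B C x = lemma B C x
  where
  lemma : ∀ B C x → C + x * (B + x * 0ℚ) ≡ B * x + C
  lemma = solve-∀ ℚ-ring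

eval-∘ₚ : ∀ p L x → eval (p ∘ₚ L) x ≡ eval p (eval L x)
eval-∘ₚ []      L x = refl
eval-∘ₚ (a ∷ p) L x
  rewrite eval-⊕ (L ⊗ (p ∘ₚ L)) (const a) x | eval-⊗ L (p ∘ₚ L) x | eval-∘ₚ p L x | eval-const a x =
  ℚP.+-comm (eval L x * eval p (eval L x)) a

eval-^ₚ : ∀ p n x → eval (p ^ₚ n) x ≡ eval p x ^ n
eval-^ₚ p zero    x = eval-const 1ℚ x
eval-^ₚ p (suc n) x = trans (eval-⊗ p (p ^ₚ n) x) (cong (eval p x *_) (eval-^ₚ p n x))

coeff-⊕ : ∀ p q k → coeff (p ⊕ q) k ≡ coeff p k + coeff q k
coeff-⊕ []      q       k       = sym (ℚP.+-identityˡ (coeff q k))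
coeff-⊕ (a ∷ p) []      k       = sym (ℚP.+-identityʳ (coeff (a ∷ p) k))
coeff-⊕ (a ∷ p) (b ∷ q) zero    = refl
coeff-⊕ (a ∷ p) (b ∷ q) (suc k) = coeff-⊕ p q k

coeff-·ₚ : ∀ c p k → coeff (c ·ₚ p) k ≡ c * coeff p k
coeff-·ₚ c []      k       = sym (ℚP.*-zeroʳ c)
coeff-·ₚ c (a ∷ p) zero    = refl
coeff-·ₚ c (a ∷ p) (suc k) = coeff-·ₚ c p k

coeff-∷⊗ : ∀ a p q k → coeff ((a ∷ p) ⊗ q) (suc k) ≡ a * coeff q (suc k) + coeff (p ⊗ q) k
coeff-∷⊗ a p q k = trans (coeff-⊕ (a ·ₚ q) (0ℚ ∷ p ⊗ q) (suc k)) (cong (_+ coeff (p ⊗ q) k) (coeff-·ₚ a q (suc k)))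

-- A polynomial is determined by its values

eval-≈ₚ[] : ∀ p → p ≈ₚ [] → ∀ x → eval p x ≡ 0ℚ
eval-≈ₚ[] []      p≈0 x = refl
eval-≈ₚ[] (c ∷ p) p≈0 x rewrite p≈0 zero | eval-≈ₚ[] p (λ k → p≈0 (suc k)) x = lemma x
  where
  lemma : ∀ x → 0ℚ + x * 0ℚ ≡ 0ℚ
  lemma = solve-∀ ℚ-ring

two : ℚ
two = 1ℚ + 1ℚ

1<2^suc : ∀ m → 1ℚ < two ^ suc m
1<2^suc zero    = ℚ.*<* (ℤ.+<+ (s≤s (s≤s z≤n)))
1<2^suc (suc m) = ℚP.<-trans (1<2^suc zero)
  (subst (_< two ^ suc (suc m)) (ℚP.*-identityʳ two) (ℚP.*-monoʳ-<-pos two (1<2^suc m)))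

2^suc-1≢0 : ∀ m → two ^ suc m + - 1ℚ ≢ 0ℚ
2^suc-1≢0 m eq = ℚP.<-irrefl (sym 2^suc≡1) (1<2^suc m)
  where
  lemma : ∀ e → e ≡ e + - 1ℚ + 1ℚ
  lemma = solve-∀ ℚ-ring
  2^suc≡1 : two ^ suc m ≡ 1ℚ
  2^suc≡1 = trans (lemma (two ^ suc m)) (trans (cong (_+ 1ℚ) eq) (ℚP.+-identityˡ 1ℚ))

-- weighted 0 cs is (p(2x) − p(x)) / x for p = c ∷ cs, and it scales the m-th
-- coefficient of cs by 2^(m+1) − 1 ≠ 0.
weighted : ℕ → Poly → Poly
weighted k []       = []
weighted k (c ∷ cs) = (two ^ suc k + - 1ℚ) * c ∷ weighted (suc k) cs

eval-weighted : ∀ k p x → eval (weighted k p) x ≡ two ^ suc k * eval p (two * x) + - eval p x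
eval-weighted k []       x = lemma (two ^ suc k)
  where
  lemma : ∀ e → 0ℚ ≡ e * 0ℚ + - 0ℚ
  lemma = solve-∀ ℚ-ring
eval-weighted k (c ∷ cs) x rewrite eval-weighted (suc k) cs x =
  lemma (two ^ suc k) c x (eval cs (two * x)) (eval cs x)
  where
  lemma : ∀ e c x u v → (e + - 1ℚ) * c + x * ((1ℚ + 1ℚ) * e * u + - v) ≡ e * (c + (1ℚ + 1ℚ) * x * u) + - (c + x * v)
  lemma = solve-∀ ℚ-ring

coeff-weighted : ∀ k p m → coeff (weighted k p) m ≡ (two ^ suc (k ℕ.+ m) + - 1ℚ) * coeff p m
coeff-weighted k []       m       = sym (ℚP.*-zeroʳ (two ^ suc (k ℕ.+ m) + - 1ℚ))
coeff-weighted k (c ∷ cs) zero    rewrite ℕP.+-identityʳ k = refl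
coeff-weighted k (c ∷ cs) (suc m) rewrite ℕP.+-suc k m = coeff-weighted (suc k) cs m

length-weighted : ∀ k p → length (weighted k p) ≡ length p
length-weighted k []       = refl
length-weighted k (c ∷ cs) = cong suc (length-weighted (suc k) cs)

-- Vanishing off 0 suffices, which is what lets the induction pass from c ∷ cs to the
-- quotient weighted 0 cs, a polynomial of smaller length.
vanishing⇒≈ₚ[] : ∀ n p → length p ≡ n → (∀ x → x ≢ 0ℚ → eval p x ≡ 0ℚ) → p ≈ₚ []
vanishing⇒≈ₚ[] _       []       _   _      = λ _ → refl
vanishing⇒≈ₚ[] (suc n) (c ∷ cs) len vanish = λ where
    zero    → constant-term
    (suc k) → cs≈0 k
  where
  open ≡-Reasoning

  2x≢0 : ∀ {x} → x ≢ 0ℚ → two * x ≢ 0ℚ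
  2x≢0 {x} x≢0 eq = x≢0 (*-cancelˡ-≡ two x 0ℚ (trans eq (sym (ℚP.*-zeroʳ two))))

  quotient : ∀ c x u v → x * (two ^ 1 * u + - v) ≡ c + two * x * u + - (c + x * v)
  quotient = solve-∀ ℚ-ring

  quotient-vanishes : ∀ x → x ≢ 0ℚ → eval (weighted 0 cs) x ≡ 0ℚ
  quotient-vanishes x x≢0 = *-cancelˡ-≡ x _ 0ℚ {{ℚ.≢-nonZero x≢0}} (begin
    x * eval (weighted 0 cs) x                        ≡⟨ cong (x *_) (eval-weighted 0 cs x) ⟩
    x * (two ^ 1 * eval cs (two * x) + - eval cs x)   ≡⟨ quotient c x (eval cs (two * x)) (eval cs x) ⟩
    eval (c ∷ cs) (two * x) + - eval (c ∷ cs) x       ≡⟨ cong₂ (λ u v → u + - v) (vanish (two * x) (2x≢0 x≢0)) (vanish x x≢0) ⟩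
    0ℚ + - 0ℚ                                         ≡⟨ ℚP.*-zeroʳ x ⟨
    x * 0ℚ                                            ∎)

  cs≈0 : cs ≈ₚ []
  cs≈0 m = *-cancelˡ-≡ (two ^ suc m + - 1ℚ) (coeff cs m) 0ℚ {{ℚ.≢-nonZero (2^suc-1≢0 m)}}
    (trans (sym (coeff-weighted 0 cs m))
      (trans (vanishing⇒≈ₚ[] n (weighted 0 cs) (trans (length-weighted 0 cs) (ℕP.suc-injective len)) quotient-vanishes m)
        (sym (ℚP.*-zeroʳ (two ^ suc m + - 1ℚ)))))

  constant-term : c ≡ 0ℚ
  constant-term = begin
    c                 ≡⟨ lemma c ⟩
    c + 1ℚ * 0ℚ       ≡⟨ cong (λ v → c + 1ℚ * v) (eval-≈ₚ[] cs cs≈0 1ℚ) ⟨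
    eval (c ∷ cs) 1ℚ  ≡⟨ vanish 1ℚ (λ ()) ⟩
    0ℚ                ∎
    where
    lemma : ∀ c → c ≡ c + 1ℚ * 0ℚ
    lemma = solve-∀ ℚ-ring

coeff-unique : ∀ p q → (∀ x → eval p x ≡ eval q x) → p ≈ₚ q
coeff-unique p q p≗q k = begin
  coeff p k                                  ≡⟨ lemma (coeff p k) (coeff q k) ⟩
  coeff p k + - 1ℚ * coeff q k + coeff q k   ≡⟨ cong (_+ coeff q k) (coeff-difference k) ⟨
  coeff (p ⊕ - 1ℚ ·ₚ q) k + coeff q k        ≡⟨ cong (_+ coeff q k) (difference≈0 k) ⟩
  0ℚ + coeff q k                             ≡⟨ ℚP.+-identityˡ (coeff q k) ⟩
  coeff q k                                  ∎
  where
  open ≡-Reasoning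
  lemma : ∀ u v → u ≡ u + - 1ℚ * v + v
  lemma = solve-∀ ℚ-ring
  cancel : ∀ v → v + - 1ℚ * v ≡ 0ℚ
  cancel = solve-∀ ℚ-ring
  coeff-difference : ∀ k → coeff (p ⊕ - 1ℚ ·ₚ q) k ≡ coeff p k + - 1ℚ * coeff q k
  coeff-difference k = trans (coeff-⊕ p (- 1ℚ ·ₚ q) k) (cong (λ v → coeff p k + v) (coeff-·ₚ (- 1ℚ) q k))
  difference≈0 : p ⊕ - 1ℚ ·ₚ q ≈ₚ []
  difference≈0 = vanishing⇒≈ₚ[] _ (p ⊕ - 1ℚ ·ₚ q) refl λ x _ →
    trans (eval-⊕ p (- 1ℚ ·ₚ q) x) (trans (cong₂ _+_ (p≗q x) (eval-·ₚ (- 1ℚ) q x)) (cancel (eval q x)))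

-- Degree bounds and the two top coefficients

DegLe-mono : ∀ {p m n} → m ℕ.≤ n → DegLe p m → DegLe p n
DegLe-mono m≤n dp k n<k = dp k (ℕP.≤-<-trans m≤n n<k)

DegLe-⊕ : ∀ {p q n} → DegLe p n → DegLe q n → DegLe (p ⊕ q) n
DegLe-⊕ {p} {q} dp dq k n<k = trans (coeff-⊕ p q k) (trans (cong₂ _+_ (dp k n<k) (dq k n<k)) (ℚP.+-identityˡ 0ℚ))

DegLe-const : ∀ c → DegLe (const c) 0
DegLe-const c (suc k) _ = refl

DegLe-tail : ∀ {c p n} → DegLe (c ∷ p) (suc n) → DegLe p n
DegLe-tail dp k n<k = dp (suc k) (s≤s n<k)

eval-DegLe0 : ∀ p x → DegLe p 0 → eval p x ≡ coeff p 0
eval-DegLe0 []      x _  = refl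
eval-DegLe0 (c ∷ p) x dp = begin
  c + x * eval p x  ≡⟨ cong (λ v → c + x * v) (eval-≈ₚ[] p (λ k → dp (suc k) (s≤s z≤n)) x) ⟩
  c + x * 0ℚ        ≡⟨ eval-const c x ⟩
  c                 ∎
  where open ≡-Reasoning

constant-⊗ : ∀ p q → DegLe p 0 → p ⊗ q ≈ₚ coeff p 0 ·ₚ q
constant-⊗ p q dp = coeff-unique (p ⊗ q) (coeff p 0 ·ₚ q) λ x → begin
  eval (p ⊗ q) x           ≡⟨ eval-⊗ p q x ⟩
  eval p x * eval q x      ≡⟨ cong (_* eval q x) (eval-DegLe0 p x dp) ⟩
  coeff p 0 * eval q x     ≡⟨ eval-·ₚ (coeff p 0) q x ⟨
  eval (coeff p 0 ·ₚ q) x  ∎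
  where open ≡-Reasoning

record TopCoeffs (p : Poly) (n : ℕ) (a b : ℚ) : Set where
  field
    degree     : DegLe p (suc n)
    leading    : coeff p (suc n) ≡ a
    subleading : coeff p n ≡ b

TopCoeffs-≈ₚ : ∀ {p q n a b} → p ≈ₚ q → TopCoeffs p n a b → TopCoeffs q n a b
TopCoeffs-≈ₚ p≈q T = record
  { degree     = λ k lt → trans (sym (p≈q k)) (degree k lt)
  ; leading    = trans (sym (p≈q _)) leading
  ; subleading = trans (sym (p≈q _)) subleading
  }
  where open TopCoeffs T

TopCoeffs-tail : ∀ {c p n a b} → TopCoeffs (c ∷ p) (suc n) a b → TopCoeffs p n a b
TopCoeffs-tail T = record { degree = DegLe-tail degree ; leading = leading ; subleading = subleading }
  where open TopCoeffs T

TopCoeffs-linear : ∀ B C → TopCoeffs (linear B C) 0 B C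
TopCoeffs-linear B C = record { degree = λ { (suc (suc k)) _ → refl ; (suc zero) (s≤s ()) } ; leading = refl ; subleading = refl }

TopCoeffs-·ₚ : ∀ {p n a b} c → TopCoeffs p n a b → TopCoeffs (c ·ₚ p) n (c * a) (c * b)
TopCoeffs-·ₚ {p} {n} c T = record
  { degree     = λ k n<k → trans (coeff-·ₚ c p k) (trans (cong (c *_) (degree k n<k)) (ℚP.*-zeroʳ c))
  ; leading    = trans (coeff-·ₚ c p (suc n)) (cong (c *_) leading)
  ; subleading = trans (coeff-·ₚ c p n) (cong (c *_) subleading)
  }
  where open TopCoeffs T

TopCoeffs-⊕-low : ∀ {p q n m a b} → TopCoeffs p n a b → DegLe q m → m ℕ.< n → TopCoeffs (p ⊕ q) n a b
TopCoeffs-⊕-low {p} {q} {n} {m} {a} {b} T dq m<n = record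
  { degree     = DegLe-⊕ {p} {q} degree (DegLe-mono {q} (ℕP.<⇒≤ (ℕP.m<n⇒m<1+n m<n)) dq)
  ; leading    = trans (coeff-⊕ p q (suc n)) (trans (cong₂ _+_ leading (dq (suc n) (ℕP.m<n⇒m<1+n m<n))) (ℚP.+-identityʳ a))
  ; subleading = trans (coeff-⊕ p q n) (trans (cong₂ _+_ subleading (dq n m<n)) (ℚP.+-identityʳ b))
  }
  where open TopCoeffs T

TopCoeffs-⊗ : ∀ {p q n m a b a′ b′} → TopCoeffs p n a b → TopCoeffs q m a′ b′ →
              TopCoeffs (p ⊗ q) (suc (n ℕ.+ m)) (a * a′) (a * b′ + b * a′)
TopCoeffs-⊗ {[]} {a′ = a′} {b′} record { leading = refl ; subleading = refl } _ = record
  { degree = λ _ _ → refl ; leading = sym (ℚP.*-zeroˡ a′) ; subleading = lemma a′ b′ }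
  where
  lemma : ∀ a′ b′ → 0ℚ ≡ 0ℚ * b′ + 0ℚ * a′
  lemma = solve-∀ ℚ-ring
TopCoeffs-⊗ {c ∷ p} {q} {suc n} {m} T T′ = record
  { degree     = λ { zero () ; (suc k) lt → trans (drop-head k (ℕP.<-trans m<k₀ (ℕP.≤-pred lt))) (degree k (ℕP.≤-pred lt)) }
  ; leading    = trans (drop-head _ m<k₀) leading
  ; subleading = trans (drop-head _ (s≤s (ℕP.m≤n+m m n))) subleading
  }
  where
  open TopCoeffs (TopCoeffs-⊗ (TopCoeffs-tail T) T′)
  m<k₀ : m ℕ.< suc (suc (n ℕ.+ m))
  m<k₀ = ℕP.m<n⇒m<1+n (s≤s (ℕP.m≤n+m m n))
  drop-head : ∀ k → m ℕ.< k → coeff ((c ∷ p) ⊗ q) (suc k) ≡ coeff (p ⊗ q) k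
  drop-head k m<k = begin
    coeff ((c ∷ p) ⊗ q) (suc k)          ≡⟨ coeff-∷⊗ c p q k ⟩
    c * coeff q (suc k) + coeff (p ⊗ q) k ≡⟨ cong (λ v → c * v + coeff (p ⊗ q) k) (TopCoeffs.degree T′ (suc k) (s≤s m<k)) ⟩
    c * 0ℚ + coeff (p ⊗ q) k             ≡⟨ lemma c (coeff (p ⊗ q) k) ⟩
    coeff (p ⊗ q) k                      ∎
    where
    open ≡-Reasoning
    lemma : ∀ c u → c * 0ℚ + u ≡ u
    lemma = solve-∀ ℚ-ring
TopCoeffs-⊗ {c ∷ p} {q} {zero} {m} {a} {b} {a′} {b′} T T′ = record
  { degree     = λ { zero () ; (suc k) lt → trans (coeff-suc k) (trans
                     (cong₂ (λ u v → c * u + a * v) (degree′ (suc k) (ℕP.<-trans (ℕP.n<1+n _) lt)) (degree′ k (ℕP.≤-pred lt)))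
                     (lemma₀ c a)) }
  ; leading    = trans (coeff-suc (suc m))
                   (trans (cong₂ (λ u v → c * u + a * v) (degree′ (suc (suc m)) ℕP.≤-refl) leading′) (lemma₁ c (a * a′)))
  ; subleading = trans (coeff-suc m) (trans (cong₂ (λ u v → c * u + a * v) leading′ subleading′)
                   (trans (cong (λ u → u * a′ + a * b′) c≡b) (lemma₂ a b a′ b′)))
  }
  where
  open TopCoeffs T′ renaming (degree to degree′; leading to leading′; subleading to subleading′)
  c≡b : c ≡ b
  c≡b = TopCoeffs.subleading T
  coeff-suc : ∀ k → coeff ((c ∷ p) ⊗ q) (suc k) ≡ c * coeff q (suc k) + a * coeff q k
  coeff-suc k = begin
    coeff ((c ∷ p) ⊗ q) (suc k)            ≡⟨ coeff-∷⊗ c p q k ⟩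
    c * coeff q (suc k) + coeff (p ⊗ q) k  ≡⟨ cong (λ v → c * coeff q (suc k) + v) p⊗q-coeff ⟩
    c * coeff q (suc k) + a * coeff q k    ∎
    where
    open ≡-Reasoning
    p⊗q-coeff : coeff (p ⊗ q) k ≡ a * coeff q k
    p⊗q-coeff = trans (constant-⊗ p q (DegLe-tail (TopCoeffs.degree T)) k)
      (trans (coeff-·ₚ (coeff p 0) q k) (cong (_* coeff q k) (TopCoeffs.leading T)))
  lemma₀ : ∀ c a → c * 0ℚ + a * 0ℚ ≡ 0ℚ
  lemma₀ = solve-∀ ℚ-ring
  lemma₁ : ∀ c u → c * 0ℚ + u ≡ u
  lemma₁ = solve-∀ ℚ-ring
  lemma₂ : ∀ a b a′ b′ → b * a′ + a * b′ ≡ a * b′ + b * a′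
  lemma₂ = solve-∀ ℚ-ring

TopCoeffs-^ₚ : ∀ {p n a b} → TopCoeffs p n a b → ∀ j →
               TopCoeffs (p ^ₚ suc j) (ℕ.pred (suc n ℕ.* suc j)) (a ^ suc j) (ℕ→ℚ (suc j) * a ^ j * b)
TopCoeffs-^ₚ {p} {n} {a} {b} T zero =
  subst (λ k → TopCoeffs (p ^ₚ 1) k (a * 1ℚ) (1ℚ * 1ℚ * b)) (sym (ℕP.*-identityʳ n))
    (subst₂ (TopCoeffs (p ^ₚ 1) n) (sym (ℚP.*-identityʳ a)) (lemma b) (TopCoeffs-≈ₚ p≈p^1 T))
  where
  lemma : ∀ b → b ≡ 1ℚ * 1ℚ * b
  lemma = solve-∀ ℚ-ring
  p≈p^1 : p ≈ₚ p ^ₚ 1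
  p≈p^1 = coeff-unique p (p ^ₚ 1) λ x →
    sym (trans (eval-^ₚ p 1 x) (ℚP.*-identityʳ (eval p x)))
TopCoeffs-^ₚ {p} {n} {a} {b} T (suc j) =
  subst (λ k → TopCoeffs (p ^ₚ suc (suc j)) k (a ^ suc (suc j)) (ℕ→ℚ (suc (suc j)) * a ^ suc j * b)) (cong suc (index n j))
    (subst (TopCoeffs (p ^ₚ suc (suc j)) _ (a ^ suc (suc j))) coefficient (TopCoeffs-⊗ T (TopCoeffs-^ₚ T j)))
  where
  index : ∀ n j → n ℕ.+ (j ℕ.+ n ℕ.* suc j) ≡ j ℕ.+ n ℕ.* suc (suc j)
  index = ℕ-solve-∀
  lemma : ∀ a b e J → a * (J * e * b) + b * (a * e) ≡ (1ℚ + J) * (a * e) * b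
  lemma = solve-∀ ℚ-ring
  coefficient : a * (ℕ→ℚ (suc j) * a ^ j * b) + b * a ^ suc j ≡ ℕ→ℚ (suc (suc j)) * a ^ suc j * b
  coefficient = trans (lemma a b (a ^ j) (ℕ→ℚ (suc j))) (cong (λ J → J * a ^ suc j * b) (sym (ℕ→ℚ-suc (suc j))))

TopCoeffs-∘ₚ-linear : ∀ {p n a b} B C → TopCoeffs p n a b →
  TopCoeffs (p ∘ₚ linear B C) n (a * B ^ suc n) (B ^ n * (b + ℕ→ℚ (suc n) * a * C))
TopCoeffs-∘ₚ-linear {[]} {n} B C record { leading = refl ; subleading = refl } = record
  { degree = λ _ _ → refl ; leading = sym (ℚP.*-zeroˡ (B ^ suc n)) ; subleading = lemma (B ^ n) (ℕ→ℚ (suc n)) C }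
  where
  lemma : ∀ e N C → 0ℚ ≡ e * (0ℚ + N * 0ℚ * C)
  lemma = solve-∀ ℚ-ring
TopCoeffs-∘ₚ-linear {c ∷ p} {zero} {a} {b} B C T = TopCoeffs-≈ₚ linear≈ (TopCoeffs-linear _ _)
  where
  open TopCoeffs T
  L = linear (a * B ^ 1) (B ^ 0 * (b + ℕ→ℚ 1 * a * C))
  lemma : ∀ a b B C x → a * (B * 1ℚ) * x + 1ℚ * (b + 1ℚ * a * C) ≡ b + (B * x + C) * a
  lemma = solve-∀ ℚ-ring
  eval-L : ∀ x → eval L x ≡ eval ((c ∷ p) ∘ₚ linear B C) x
  eval-L x = begin
    eval L x                                  ≡⟨ eval-linear (a * B ^ 1) (B ^ 0 * (b + ℕ→ℚ 1 * a * C)) x ⟩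
    a * (B * 1ℚ) * x + 1ℚ * (b + 1ℚ * a * C)  ≡⟨ lemma a b B C x ⟩
    b + (B * x + C) * a                       ≡⟨ cong₂ (λ u v → u + (B * x + C) * v) subleading leading ⟨
    c + (B * x + C) * coeff p 0               ≡⟨ cong (λ v → c + v * coeff p 0) (eval-linear B C x) ⟨
    c + y * coeff p 0                         ≡⟨ cong (λ v → c + y * v) (eval-DegLe0 p y (DegLe-tail {c} degree)) ⟨
    eval (c ∷ p) y                            ≡⟨ eval-∘ₚ (c ∷ p) (linear B C) x ⟨
    eval ((c ∷ p) ∘ₚ linear B C) x            ∎
    where
    open ≡-Reasoning
    y = eval (linear B C) x
  linear≈ : L ≈ₚ (c ∷ p) ∘ₚ linear B C
  linear≈ = coeff-unique L ((c ∷ p) ∘ₚ linear B C) eval-L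
TopCoeffs-∘ₚ-linear {c ∷ p} {suc n} {a} {b} B C T =
  subst₂ (TopCoeffs ((c ∷ p) ∘ₚ linear B C) (suc n)) leading subleading
    (TopCoeffs-⊕-low (TopCoeffs-⊗ (TopCoeffs-linear B C) (TopCoeffs-∘ₚ-linear B C (TopCoeffs-tail T))) (DegLe-const c) (s≤s z≤n))
  where
  e = B ^ n
  N = ℕ→ℚ (suc n)
  leading-lemma : ∀ a B e → B * (a * (B * e)) ≡ a * (B * (B * e))
  leading-lemma = solve-∀ ℚ-ring
  leading : B * (a * B ^ suc n) ≡ a * B ^ suc (suc n)
  leading = leading-lemma a B e
  subleading-lemma : ∀ a b B C e N → B * (e * (b + N * a * C)) + C * (a * (B * e)) ≡ B * e * (b + (1ℚ + N) * a * C)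
  subleading-lemma = solve-∀ ℚ-ring
  subleading : B * (e * (b + N * a * C)) + C * (a * B ^ suc n) ≡ B ^ suc n * (b + ℕ→ℚ (suc (suc n)) * a * C)
  subleading = trans (subleading-lemma a b B C e N) (cong (λ M → B ^ suc n * (b + M * a * C)) (sym (ℕ→ℚ-suc (suc n))))

-- Rough numbers

∣! : ∀ {m n} → 0 ℕ.< m → m ℕ.≤ n → m ∣ n !
∣! {suc m} {zero}  _   ()
∣! {m}     {suc n} m>0 m≤1+n with ℕP.m≤n⇒m<n∨m≡n m≤1+n
... | inj₁ m<1+n = ℕD.∣n⇒∣m*n (suc n) (∣! m>0 (ℕP.≤-pred m<1+n))
... | inj₂ refl  = ℕD.m∣m*n (n !)

prime∤! : ∀ {p} n → Prime p → n ℕ.< p → p ∤ n !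
prime∤! zero    p-prime _     p∣1 = ¬prime[1] (subst Prime (ℕD.∣1⇒≡1 p∣1) p-prime)
prime∤! (suc n) p-prime 1+n<p p∣! with euclidsLemma (suc n) (n !) p-prime p∣!
... | inj₁ p∣1+n = ℕP.<⇒≱ 1+n<p (ℕD.∣⇒≤ p∣1+n)
... | inj₂ p∣n!  = prime∤! n p-prime (ℕP.<-trans (ℕP.n<1+n n) 1+n<p) p∣n!

rough⇒coprime : ∀ {m n k} → m Rough n → 0 ℕ.< k → k ℕ.< m → Coprime k n
rough⇒coprime {k = suc k} _     _ _   {zero}        (0∣k , _)   = ⊥-elim (ℕP.1+n≢0 (ℕD.0∣⇒≡0 0∣k))
rough⇒coprime             _     _ _   {suc zero}    _           = refl
rough⇒coprime {k = suc k} rough _ k<m {suc (suc i)} (i∣k , i∣n) =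
  ⊥-elim (rough (hasNonTrivialDivisor (ℕP.≤-<-trans (ℕD.∣⇒≤ i∣k) k<m) i∣n))

coprime-divisor-^ : ∀ {m n o} k → Coprime m n → m ∣ n ℕ.^ k ℕ.* o → m ∣ o
coprime-divisor-^ {m} {n} {o} zero    _   m∣ = subst (m ∣_) (ℕP.+-identityʳ o) m∣
coprime-divisor-^ {m} {n} {o} (suc k) cop m∣ =
  coprime-divisor-^ k cop (Coprimality.coprime-divisor cop (subst (m ∣_) (ℕP.*-assoc n (n ℕ.^ k) o) m∣))

rough-+ : ∀ {m} x y → m Rough ℤ.∣ x ∣ → (∀ {d} → 0 ℕ.< d → d ℕ.< m → d ∣ ℤ.∣ y ∣) → m Rough ℤ.∣ x ℤ.+ y ∣
rough-+ x y rough small∣y (hasNonTrivialDivisor {d} d<m d∣x+y) =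
  rough (hasNonTrivialDivisor d<m (ℤD.∣⇒∣ᵤ {+ d} {x} (ℤD.∣m+n∣n⇒∣m (ℤD.∣ᵤ⇒∣ {+ d} {x ℤ.+ y} d∣x+y) d∣y)))
  where
  d∣y : + d ℤD.∣ y
  d∣y = ℤD.∣ᵤ⇒∣ {+ d} {y} (small∣y (ℕP.<-trans (s≤s z≤n) (ℕ.nonTrivial⇒n>1 d)) d<m)

-- If m divides the m-rough X = A q + p then m is prime; adding (m − 1)! q to X keeps
-- every smaller divisor out and, since m divides neither (m − 1)! nor q, pushes m out.
rough-step : ∀ (p : ℤ) q → Coprime ℤ.∣ p ∣ q → ∀ k A →
  let m = suc (suc k) in m Rough ℤ.∣ A ℤ.* + q ℤ.+ p ∣ → m ∣ ℤ.∣ A ℤ.* + q ℤ.+ p ∣ →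
  suc m Rough ℤ.∣ (A ℤ.+ + (suc k !)) ℤ.* + q ℤ.+ p ∣
rough-step p q cop k A rough m∣X =
  subst (λ z → suc m Rough ℤ.∣ z ∣) (sym (shift A (+ (suc k !)) (+ q) p)) (∤⇒rough-suc m∤X+M (rough-+ X M rough small∣M))
  where
  m = suc (suc k)
  X = A ℤ.* + q ℤ.+ p
  M = + (suc k !) ℤ.* + q

  shift : ∀ A F q p → (A ℤ.+ F) ℤ.* q ℤ.+ p ≡ A ℤ.* q ℤ.+ p ℤ.+ F ℤ.* q
  shift = ℤ-solve-∀

  ∣M∣≡ : ℤ.∣ M ∣ ≡ suc k ! ℕ.* q
  ∣M∣≡ = ℤP.abs-* (+ (suc k !)) (+ q)

  small∣M : ∀ {d} → 0 ℕ.< d → d ℕ.< m → d ∣ ℤ.∣ M ∣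
  small∣M d>0 d<m = subst (_ ∣_) (sym ∣M∣≡) (ℕD.∣m⇒∣m*n q (∣! d>0 (ℕP.≤-pred d<m)))

  m-prime : Prime m
  m-prime = rough∧∣⇒prime rough m∣X

  m∤q : m ∤ q
  m∤q m∣q = contradiction (cop (m∣p , m∣q)) λ ()
    where
    m∣p : m ∣ ℤ.∣ p ∣
    m∣p = ℤD.∣⇒∣ᵤ {+ m} {p}
      (ℤD.∣m+n∣m⇒∣n (ℤD.∣ᵤ⇒∣ {+ m} {X} m∣X) (ℤD.∣n⇒∣m*n A (ℤD.∣ᵤ⇒∣ {+ m} {+ q} m∣q)))

  m∤X+M : m ∤ ℤ.∣ X ℤ.+ M ∣
  m∤X+M m∣X+M with euclidsLemma (suc k !) q m-prime (subst (m ∣_) ∣M∣≡ m∣M)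
    where
    m∣M : m ∣ ℤ.∣ M ∣
    m∣M = ℤD.∣⇒∣ᵤ {+ m} {M} (ℤD.∣m+n∣m⇒∣n (ℤD.∣ᵤ⇒∣ {+ m} {X ℤ.+ M} m∣X+M) (ℤD.∣ᵤ⇒∣ {+ m} {X} m∣X))
  ... | inj₁ m∣! = prime∤! (suc k) m-prime ℕP.≤-refl m∣!
  ... | inj₂ m∣q = m∤q m∣q

rough-shift : ∀ (p : ℤ) q → Coprime ℤ.∣ p ∣ q → ∀ m → ∃[ A ] m Rough ℤ.∣ A ℤ.* + q ℤ.+ p ∣
rough-shift p q cop zero          = + 0 , 0-rough
rough-shift p q cop (suc zero)    = + 0 , 1-rough
rough-shift p q cop (suc (suc zero)) = + 0 , 2-rough
rough-shift p q cop (suc (suc (suc k))) with rough-shift p q cop (suc (suc k))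
... | A , rough with suc (suc k) ℕD.∣? ℤ.∣ A ℤ.* + q ℤ.+ p ∣
...   | no  m∤X = A , ∤⇒rough-suc m∤X rough
...   | yes m∣X = A ℤ.+ + (suc k !) , rough-step p q cop k A rough m∣X

rough-power-equation : ∀ {m x y i₁ i₂} N → m Rough x → 0 ℕ.< i₁ → i₁ ℕ.< i₂ → i₂ ℕ.< m →
                       i₂ ℕ.* y ℕ.^ N ≢ i₁ ℕ.* x ℕ.^ N
rough-power-equation {x = x} {y} {suc i₁} {i₂} N rough _ i₁<i₂ i₂<m eq =
  ℕP.<⇒≱ i₁<i₂ (ℕD.∣⇒≤ (coprime-divisor-^ N (rough⇒coprime rough (ℕP.<-trans (s≤s z≤n) i₁<i₂) i₂<m) i₂∣))
  where
  i₂∣ : i₂ ∣ x ℕ.^ N ℕ.* suc i₁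
  i₂∣ = divides (y ℕ.^ N) (trans (ℕP.*-comm (x ℕ.^ N) (suc i₁)) (trans (sym eq) (ℕP.*-comm i₂ (y ℕ.^ N))))

module _ {A : Set} {_≼_ : A → A → Set} (≼-trans : Transitive _≼_) (≼-total : Total _≼_) where

  ≼-refl : ∀ x → x ≼ x
  ≼-refl x with ≼-total x x
  ... | inj₁ x≼x = x≼x
  ... | inj₂ x≼x = x≼x

  maximum : ∀ (xs : List A) → xs ≢ [] → ∃[ m ] (m ∈ xs × All (_≼ m) xs)
  maximum []           []≢[] = ⊥-elim ([]≢[] refl)
  maximum (x ∷ [])     _     = x , here refl , ≼-refl x ∷ []
  maximum (x ∷ y ∷ ys) _ with maximum (y ∷ ys) (λ ())
  ... | m , m∈ , m-max with ≼-total x m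
  ...   | inj₁ x≼m = m , there m∈ , x≼m ∷ m-max
  ...   | inj₂ m≼x = x , here refl , ≼-refl x ∷ All.map (λ z≼m → ≼-trans z≼m m≼x) m-max

_⊑_ : ℕ × ℕ → ℕ × ℕ → Set
(i₂ , j₂) ⊑ (i₁ , j₁) = j₂ ℕ.< j₁ ⊎ (j₂ ≡ j₁ × i₁ ℕ.≤ i₂)

⊑-trans : Transitive _⊑_
⊑-trans (inj₁ j₁<j₂)         (inj₁ j₂<j₃)         = inj₁ (ℕP.<-trans j₁<j₂ j₂<j₃)
⊑-trans (inj₁ j₁<j₂)         (inj₂ (refl , _))    = inj₁ j₁<j₂
⊑-trans (inj₂ (refl , _))    (inj₁ j₂<j₃)         = inj₁ j₂<j₃
⊑-trans (inj₂ (refl , i₂≤i₁)) (inj₂ (refl , i₃≤i₂)) = inj₂ (refl , ℕP.≤-trans i₃≤i₂ i₂≤i₁)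

⊑-total : Total _⊑_
⊑-total (i₁ , j₁) (i₂ , j₂) with ℕP.<-cmp j₁ j₂
... | tri< j₁<j₂ _ _ = inj₁ (inj₁ j₁<j₂)
... | tri> _ _ j₂<j₁ = inj₂ (inj₁ j₂<j₁)
... | tri≈ _ refl _ with ℕP.≤-total i₁ i₂
...   | inj₁ i₁≤i₂ = inj₂ (inj₂ (refl , i₁≤i₂))
...   | inj₂ i₂≤i₁ = inj₁ (inj₂ (refl , i₂≤i₁))

-- The top two coefficients of I₁ (g^j ∘ (x + A)) and I₂ (g^j ∘ (Bx + C)) equated, where
-- a is the leading coefficient of g, b the next one, e = a^(j−1), J = j, D = deg g and N = D J.
same-degree-relation : ∀ {I₁ I₂ J D N a e b B Bⁿ 1ⁿ A C} → 1ⁿ ≡ 1ℚ → N ≡ D * J →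
  0ℚ < I₁ → 0ℚ < J → 0ℚ < a → 0ℚ < e →
  I₁ * (a * e) * (1ℚ * 1ⁿ) ≡ I₂ * (a * e) * (B * Bⁿ) →
  1ⁿ * (I₁ * (J * e * b) + N * (I₁ * (a * e)) * A) ≡ Bⁿ * (I₂ * (J * e * b) + N * (I₂ * (a * e)) * C) →
  I₁ ≡ I₂ * (B * Bⁿ) × B * (b + D * a * A) ≡ b + D * a * C
same-degree-relation {I₁} {I₂} {J} {D} {_} {a} {e} {b} {B} {Bⁿ} {_} {A} {C} refl refl I₁>0 J>0 a>0 e>0 leading subleading =
  I₁≡ , *-cancelˡ-≡ (I₁ * J * e) _ _ {{ℚ.>-nonZero (*-pos (*-pos I₁>0 J>0) e>0)}} (begin
    I₁ * J * e * (B * (b + D * a * A))                         ≡⟨ lemma₂ I₁ J D a e b B A ⟩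
    B * (1ℚ * (I₁ * (J * e * b) + D * J * (I₁ * (a * e)) * A))  ≡⟨ cong (B *_) subleading ⟩
    B * (Bⁿ * (I₂ * (J * e * b) + D * J * (I₂ * (a * e)) * C))  ≡⟨ lemma₃ I₂ J D a e b B Bⁿ C ⟩
    I₂ * (B * Bⁿ) * J * e * (b + D * a * C)                    ≡⟨ cong (λ I → I * J * e * (b + D * a * C)) I₁≡ ⟨
    I₁ * J * e * (b + D * a * C)                               ∎)
  where
  open ≡-Reasoning
  rearrange₁ : ∀ I₁ a e → a * e * I₁ ≡ I₁ * (a * e) * (1ℚ * 1ℚ)
  rearrange₁ = solve-∀ ℚ-ring
  rearrange₂ : ∀ I₂ a e B Bⁿ → I₂ * (a * e) * (B * Bⁿ) ≡ a * e * (I₂ * (B * Bⁿ))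
  rearrange₂ = solve-∀ ℚ-ring
  I₁≡ : I₁ ≡ I₂ * (B * Bⁿ)
  I₁≡ = *-cancelˡ-≡ (a * e) _ _ {{ℚ.>-nonZero (*-pos a>0 e>0)}}
    (trans (rearrange₁ I₁ a e) (trans leading (rearrange₂ I₂ a e B Bⁿ)))
  lemma₂ : ∀ I₁ J D a e b B A →
           I₁ * J * e * (B * (b + D * a * A)) ≡ B * (1ℚ * (I₁ * (J * e * b) + D * J * (I₁ * (a * e)) * A))
  lemma₂ = solve-∀ ℚ-ring
  lemma₃ : ∀ I₂ J D a e b B Bⁿ C →
           B * (Bⁿ * (I₂ * (J * e * b) + D * J * (I₂ * (a * e)) * C)) ≡ I₂ * (B * Bⁿ) * J * e * (b + D * a * C)
  lemma₃ = solve-∀ ℚ-ring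

power-relation : ∀ {I₁ I₂ B X Y} N → I₁ ≡ I₂ * B ^ N → Y ≡ B * X → I₂ * Y ^ N ≡ I₁ * X ^ N
power-relation {I₁} {I₂} {B} {X} {Y} N refl refl = begin
  I₂ * (B * X) ^ N        ≡⟨ cong (I₂ *_) (^-distribʳ-* B X N) ⟩
  I₂ * (B ^ N * X ^ N)    ≡⟨ ℚP.*-assoc I₂ (B ^ N) (X ^ N) ⟨
  I₂ * B ^ N * X ^ N      ∎
  where open ≡-Reasoning

module Family (g : Poly) (d′ : ℕ) (g-deg : DegLe g (suc d′)) (a>0 : 0ℚ < coeff g (suc d′))
              (h : ℕ → ℕ → Poly) (ℓ₁ ℓ₂ : ℕ)
              (h-deg : ∀ i j → InI (suc d′) ℓ₁ ℓ₂ (i , j) → DegLe (h i j) (suc d′ ℕ.* j ℕ.∸ 2)) where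

  a b : ℚ
  a = coeff g (suc d′)
  b = coeff g d′

  F : ℕ → ℕ → Poly
  F i j = ℕ→ℚ i ·ₚ g ^ₚ j ⊕ h i j

  eval-F∘ : ∀ i j L x → eval (F i j ∘ₚ L) x ≡ fij g h (i , j) (eval L x)
  eval-F∘ i j L x
    rewrite eval-∘ₚ (F i j) L x | eval-⊕ (ℕ→ℚ i ·ₚ g ^ₚ j) (h i j) (eval L x)
          | eval-·ₚ (ℕ→ℚ i) (g ^ₚ j) (eval L x) | eval-^ₚ g j (eval L x) = refl

  sides-≈ₚ : ∀ i₁ j₁ i₂ j₂ A B C D → (∀ x → fij g h (i₁ , j₁) (x + A) ≡ fij g h (i₂ , j₂) (B * x + C) + D) →
             F i₁ j₁ ∘ₚ linear 1ℚ A ≈ₚ F i₂ j₂ ∘ₚ linear B C ⊕ const D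
  sides-≈ₚ i₁ j₁ i₂ j₂ A B C D eq = coeff-unique lhs rhs λ x → trans (eval-lhs x) (trans (eq x) (sym (eval-rhs x)))
    where
    lhs = F i₁ j₁ ∘ₚ linear 1ℚ A
    rhs = F i₂ j₂ ∘ₚ linear B C ⊕ const D
    eval-lhs : ∀ x → eval lhs x ≡ fij g h (i₁ , j₁) (x + A)
    eval-lhs x = trans (eval-F∘ i₁ j₁ (linear 1ℚ A) x)
      (cong (fij g h (i₁ , j₁)) (trans (eval-linear 1ℚ A x) (cong (_+ A) (ℚP.*-identityˡ x))))
    eval-rhs : ∀ x → eval rhs x ≡ fij g h (i₂ , j₂) (B * x + C) + D
    eval-rhs x = trans (eval-⊕ (F i₂ j₂ ∘ₚ linear B C) (const D) x)
      (cong₂ _+_ (trans (eval-F∘ i₂ j₂ (linear B C) x) (cong (fij g h (i₂ , j₂)) (eval-linear B C x))) (eval-const D x))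

  g-top : TopCoeffs g d′ a b
  g-top = record { degree = g-deg ; leading = refl ; subleading = refl }

  deg : ℕ → ℕ
  deg j = suc d′ ℕ.* suc j

  lead sublead : ℕ → ℕ → ℚ
  lead i j    = ℕ→ℚ i * a ^ suc j
  sublead i j = ℕ→ℚ i * (ℕ→ℚ (suc j) * a ^ j * b)

  TopCoeffs-F∘ : ∀ {i j} → InI (suc d′) ℓ₁ ℓ₂ (i , suc j) → ∀ B C →
    TopCoeffs (F i (suc j) ∘ₚ linear B C) (ℕ.pred (deg j))
      (lead i j * B ^ deg j) (B ^ ℕ.pred (deg j) * (sublead i j + ℕ→ℚ (deg j) * lead i j * C))
  TopCoeffs-F∘ {i} {j} I B C = TopCoeffs-∘ₚ-linear B C
    (TopCoeffs-⊕-low (TopCoeffs-·ₚ (ℕ→ℚ i) (TopCoeffs-^ₚ g-top j)) (h-deg i (suc j) I) (∸2<pred (proj₂ (proj₂ I))))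
    where
    ∸2<pred : ∀ {N} → 2 ℕ.≤ N → N ℕ.∸ 2 ℕ.< ℕ.pred N
    ∸2<pred {suc (suc N)} _         = ℕP.n<1+n N
    ∸2<pred {suc zero}    (s≤s ())

  TopCoeffs-F∘⊕ : ∀ {i j} → InI (suc d′) ℓ₁ ℓ₂ (i , suc j) → ∀ B C D →
    TopCoeffs (F i (suc j) ∘ₚ linear B C ⊕ const D) (ℕ.pred (deg j))
      (lead i j * B ^ deg j) (B ^ ℕ.pred (deg j) * (sublead i j + ℕ→ℚ (deg j) * lead i j * C))
  TopCoeffs-F∘⊕ I B C D = TopCoeffs-⊕-low (TopCoeffs-F∘ I B C) (DegLe-const D) (0<pred (proj₂ (proj₂ I)))
    where
    0<pred : ∀ {N} → 2 ℕ.≤ N → 0 ℕ.< ℕ.pred N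
    0<pred {suc (suc N)} _         = s≤s z≤n
    0<pred {suc zero}    (s≤s ())

  lower-degree-differs : ∀ {i₁ j₁ i₂ j₂} → InI (suc d′) ℓ₁ ℓ₂ (i₁ , suc j₁) → InI (suc d′) ℓ₁ ℓ₂ (i₂ , suc j₂) →
    j₂ ℕ.< j₁ → ∀ A B C D → ¬ F i₁ (suc j₁) ∘ₚ linear 1ℚ A ≈ₚ F i₂ (suc j₂) ∘ₚ linear B C ⊕ const D
  lower-degree-differs {suc i₁} {j₁} {i₂} {j₂} I₁ I₂ j₂<j₁ A B C D sides =
    ℚP.<⇒≢ lead>0 (sym (trans (sym (TopCoeffs.leading (TopCoeffs-F∘ I₁ 1ℚ A))) (trans (sides (deg j₁)) rhs≡0)))
    where
    rhs≡0 : coeff (F i₂ (suc j₂) ∘ₚ linear B C ⊕ const D) (deg j₁) ≡ 0ℚ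
    rhs≡0 = TopCoeffs.degree (TopCoeffs-F∘⊕ I₂ B C D) (deg j₁) (ℕP.*-monoʳ-< (suc d′) (s≤s j₂<j₁))
    lead>0 : 0ℚ < lead (suc i₁) j₁ * 1ℚ ^ deg j₁
    lead>0 = *-pos (*-pos (ℕ→ℚ-pos i₁) (^-pos (suc j₁) a>0)) (^-pos (deg j₁) (ℚP.positive⁻¹ 1ℚ))

  u : ℚ
  u = ℕ→ℚ (suc d′) * a

  u>0 : 0ℚ < u
  u>0 = *-pos (ℕ→ℚ-pos d′) a>0

  same-degree-coefficients : ∀ {i₁ i₂ j} → InI (suc d′) ℓ₁ ℓ₂ (i₁ , suc j) → InI (suc d′) ℓ₁ ℓ₂ (i₂ , suc j) →
    ∀ A B C D → F i₁ (suc j) ∘ₚ linear 1ℚ A ≈ₚ F i₂ (suc j) ∘ₚ linear B C ⊕ const D →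
    ℕ→ℚ i₁ ≡ ℕ→ℚ i₂ * B ^ deg j × B * (b + u * A) ≡ b + u * C
  same-degree-coefficients {suc i₁} {i₂} {j} I₁ I₂ A B C D sides =
    same-degree-relation {I₁ = ℕ→ℚ (suc i₁)} {ℕ→ℚ i₂} {ℕ→ℚ (suc j)} {ℕ→ℚ (suc d′)}
                         {a = a} {a ^ j} {b} {B} {A = A} {C = C}
      (1^n≡1 (ℕ.pred (deg j))) (ℕ→ℚ-* (suc d′) (suc j)) (ℕ→ℚ-pos i₁) (ℕ→ℚ-pos j) a>0 (^-pos j a>0)
      (trans (sym leading₁) (trans (sides (deg j)) leading₂))
      (trans (sym subleading₁) (trans (sides (ℕ.pred (deg j))) subleading₂))
    where
    open TopCoeffs (TopCoeffs-F∘ I₁ 1ℚ A) renaming (leading to leading₁; subleading to subleading₁)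
    open TopCoeffs (TopCoeffs-F∘⊕ I₂ B C D) renaming (leading to leading₂; subleading to subleading₂)

  -- With t = b / u = p / q, the relation B (b + u A) = b + u C of same-degree-coefficients
  -- reads B (t + A) = t + C, i.e. C q + p = B (A q + p).
  t : ℚ
  t = (ℚ.1/ u) {{ℚ.>-nonZero u>0}} * b

  p : ℤ
  p = ℚ.↥ t

  q : ℕ
  q = ℚ.↧ₙ t

  coprime-p-q : Coprime ℤ.∣ p ∣ q
  coprime-p-q with t
  ... | mkℚ _ _ coprime = Coprimality.recompute coprime

  u*t≡b : u * t ≡ b
  u*t≡b = trans (sym (ℚP.*-assoc u _ b)) (trans (cong (_* b) (ℚP.*-inverseʳ u {{ℚ.>-nonZero u>0}})) (ℚP.*-identityˡ b))

  ℤ→ℚ-affine : ∀ A → ℤ→ℚ (A ℤ.* + q ℤ.+ p) ≡ (ℤ→ℚ A + t) * ℕ→ℚ q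
  ℤ→ℚ-affine A = begin
    ℤ→ℚ (A ℤ.* + q ℤ.+ p)              ≡⟨ ℤ→ℚ-+ (A ℤ.* + q) p ⟩
    ℤ→ℚ (A ℤ.* + q) + ℤ→ℚ p            ≡⟨ cong₂ _+_ (ℤ→ℚ-* A (+ q)) (ℤ→ℚ-↥ t) ⟩
    ℤ→ℚ A * ℕ→ℚ q + t * ℕ→ℚ q          ≡⟨ ℚP.*-distribʳ-+ (ℕ→ℚ q) (ℤ→ℚ A) t ⟨
    (ℤ→ℚ A + t) * ℕ→ℚ q                ∎
    where open ≡-Reasoning

  integral-relation : ∀ A B C → B * (b + u * ℤ→ℚ A) ≡ b + u * ℤ→ℚ C →
                      ℤ→ℚ (C ℤ.* + q ℤ.+ p) ≡ B * ℤ→ℚ (A ℤ.* + q ℤ.+ p)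
  integral-relation A B C relation = begin
    ℤ→ℚ (C ℤ.* + q ℤ.+ p)          ≡⟨ ℤ→ℚ-affine C ⟩
    (ℤ→ℚ C + t) * ℕ→ℚ q            ≡⟨ cong (_* ℕ→ℚ q) shifted ⟨
    B * (ℤ→ℚ A + t) * ℕ→ℚ q        ≡⟨ ℚP.*-assoc B _ (ℕ→ℚ q) ⟩
    B * ((ℤ→ℚ A + t) * ℕ→ℚ q)      ≡⟨ cong (B *_) (ℤ→ℚ-affine A) ⟨
    B * ℤ→ℚ (A ℤ.* + q ℤ.+ p)      ∎
    where
    open ≡-Reasoning
    lemma₁ : ∀ u B A t → u * (B * (A + t)) ≡ B * (u * t + u * A)
    lemma₁ = solve-∀ ℚ-ring
    lemma₂ : ∀ u C t → u * t + u * C ≡ u * (C + t)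
    lemma₂ = solve-∀ ℚ-ring
    shifted : B * (ℤ→ℚ A + t) ≡ ℤ→ℚ C + t
    shifted = *-cancelˡ-≡ u _ _ {{ℚ.>-nonZero u>0}} (begin
      u * (B * (ℤ→ℚ A + t))          ≡⟨ lemma₁ u B (ℤ→ℚ A) t ⟩
      B * (u * t + u * ℤ→ℚ A)        ≡⟨ cong (λ v → B * (v + u * ℤ→ℚ A)) u*t≡b ⟩
      B * (b + u * ℤ→ℚ A)            ≡⟨ relation ⟩
      b + u * ℤ→ℚ C                  ≡⟨ cong (λ v → v + u * ℤ→ℚ C) u*t≡b ⟨
      u * t + u * ℤ→ℚ C              ≡⟨ lemma₂ u (ℤ→ℚ C) t ⟩
      u * (ℤ→ℚ C + t)                ∎)

  shifted-differ : ∀ {p₁ p₂} A → suc ℓ₁ Rough ℤ.∣ A ℤ.* + q ℤ.+ p ∣ →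
    InI (suc d′) ℓ₁ ℓ₂ p₁ → InI (suc d′) ℓ₁ ℓ₂ p₂ → p₂ ⊑ p₁ → p₂ ≢ p₁ → ∀ B C D →
    ¬ (∀ x → fij g h p₁ (x + ℤ→ℚ A) ≡ fij g h p₂ (B * x + ℤ→ℚ C) + ℤ→ℚ D)
  shifted-differ {_ , zero} _ _ (_ , (() , _) , _) _ _ _ _ _ _ _
  shifted-differ {_ , suc _} {_ , zero} _ _ _ (_ , (() , _) , _) _ _ _ _ _ _
  shifted-differ {i₁ , suc j₁} {i₂ , suc j₂} A _ I₁ I₂ (inj₁ j₂<j₁) _ B C D eq =
    lower-degree-differs I₁ I₂ (ℕP.≤-pred j₂<j₁) _ _ _ _ (sides-≈ₚ i₁ (suc j₁) i₂ (suc j₂) _ B _ _ eq)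
  shifted-differ {i₁ , suc j} {i₂ , suc .j} A rough I₁ I₂ (inj₂ (refl , i₁≤i₂)) p₂≢p₁ B C D eq =
    rough-power-equation {x = ℤ.∣ X ∣} {ℤ.∣ Y ∣} (deg j) rough (proj₁ (proj₁ I₁)) i₁<i₂ (s≤s (proj₂ (proj₁ I₂)))
      (monomial-cast i₁ i₂ X Y (deg j)
        (power-relation {I₁ = ℕ→ℚ i₁} {I₂ = ℕ→ℚ i₂} {B = B} {X = ℤ→ℚ X} {Y = ℤ→ℚ Y} (deg j)
          (proj₁ relation) (integral-relation A B C (proj₂ relation))))
    where
    X = A ℤ.* + q ℤ.+ p
    Y = C ℤ.* + q ℤ.+ p
    relation : ℕ→ℚ i₁ ≡ ℕ→ℚ i₂ * B ^ deg j × B * (b + u * ℤ→ℚ A) ≡ b + u * ℤ→ℚ C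
    relation = same-degree-coefficients I₁ I₂ (ℤ→ℚ A) B (ℤ→ℚ C) (ℤ→ℚ D)
      (sides-≈ₚ i₁ (suc j) i₂ (suc j) (ℤ→ℚ A) B (ℤ→ℚ C) (ℤ→ℚ D) eq)
    i₁<i₂ : i₁ ℕ.< i₂
    i₁<i₂ = ℕP.≤∧≢⇒< i₁≤i₂ (λ i₁≡i₂ → p₂≢p₁ (cong (_, suc j) (sym i₁≡i₂)))

lemma2 : (g : Poly) (d : ℕ) → 1 ℕ.≤ d → IntegerValued g → DegPosLead g d →
         (ℓ₁ ℓ₂ : ℕ) → 1 ℕ.≤ ℓ₁ → 1 ℕ.≤ ℓ₂ →
         (h : ℕ → ℕ → Poly) →
         (∀ i j → InI d ℓ₁ ℓ₂ (i , j) → IntegerValued (h i j) × DegLe (h i j) (d ℕ.* j ℕ.∸ 2)) →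
         (S : List (ℕ × ℕ)) → S ≢ [] → All (InI d ℓ₁ ℓ₂) S →
         ∃[ p₁ ] (p₁ ∈ S × ∃[ A ] (∀ p₂ → p₂ ∈ S → p₂ ≢ p₁ →
           ∀ (B : ℚ) (C D : ℤ) → 0ℚ < B →
           ¬ (∀ (x : ℚ) → fij g h p₁ (x + ℤ→ℚ A) ≡ fij g h p₂ (B * x + ℤ→ℚ C) + ℤ→ℚ D)))
lemma2 g (suc d′) _ _ (g-deg , a>0) ℓ₁ ℓ₂ _ _ h h-ok S S≢[] S⊆I
  with maximum ⊑-trans ⊑-total S S≢[]
... | p₁ , p₁∈S , p₁-max =
  p₁ , p₁∈S , A , λ p₂ p₂∈S p₂≢p₁ B C D _ →
    shifted-differ A rough (lookup S⊆I p₁∈S) (lookup S⊆I p₂∈S) (lookup p₁-max p₂∈S) p₂≢p₁ B C D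
  where
  open Family g d′ g-deg a>0 h ℓ₁ ℓ₂ (λ i j I → proj₂ (h-ok i j I))
  A = proj₁ (rough-shift p q coprime-p-q (suc ℓ₁))
  rough = proj₂ (rough-shift p q coprime-p-q (suc ℓ₁))
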